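{- Let $Y$ be a set with $5$ elements and let $u\in\mathcal{U}^Y$. If $u$ is not cyclic, then there are exactly two $4$-element subsets $Z\subseteq Y$ such that $u_Z$ is not cyclic.
   Context: A cyclic ordering of a finite set $Y$ is an equivalence class of linear orderings of $Y$ modulo rotation; $C\succeq[y_1,\dots,y_k]$ means $[y_1,\dots,y_k]$ arises from $C$ by omitting entries. For a cyclic ordering $C$ of a finite set $W$, $u^C\in\mathrm{GF}(2)^{W^3}$ has $u^C(x,y,z)=1$ iff $x,y,z$ are distinct and $C\succeq[x,y,z]$; a vector $u\in\mathrm{GF}(2)^{W^3}$ is cyclic if $u=u^C$ for some cyclic ordering $C$ of $W$. For $Z\subseteq Y$, $u_Z$ is the restriction of $u$ to the entries indexed by $Z^3$. $\mathcal{U}^Y$ is the affine subspace of all $u\in\mathrm{GF}(2)^{Y^3}$ such that: $u(x,x,y)=0$ for all $x,y$; $u(x,y,z)+u(y,z,x)=0$ for all $x,y,z$; $u(x,y,z)+u(y,x,z)=1$ for pairwise distinct $x,y,z$; $u(t,x,y)+u(t,x,z)+u(t,y,z)+u(x,y,z)=0$ for pairwise distinct $t,x,y,z$. -}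

module Defs where

open import Data.Bool using (Bool; true; false; _xor_)
open import Data.Nat using (ℕ)
open import Data.Fin using (Fin)
open import Data.Fin.Subset using (Subset; _∈_; ⊤; ∣_∣)
open import Data.List using (List; _∷_; []; _++_)
open import Data.List.Relation.Unary.Unique.Propositional using (Unique)
import Data.List.Membership.Propositional as LM
open import Data.List.Relation.Binary.Sublist.Propositional using (_⊆_)
open import Data.Product using (Σ; ∃; ∃-syntax; _×_; _,_)
open import Relation.Binary.PropositionalEquality using (_≡_; _≢_)
open import Relation.Nullary using (¬_)
open import Function.Bundles using (_⇔_)

-- GF(2) is modelled by Bool, with addition _xor_ (false = 0, true = 1).
-- A vector u ∈ GF(2)^{Y^3} for Y = Fin n.
Vec3 : ℕ → Set
Vec3 n = Fin n → Fin n → Fin n → Bool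

Distinct3 : ∀ {n} → Fin n → Fin n → Fin n → Set
Distinct3 x y z = x ≢ y × y ≢ z × x ≢ z

-- A cyclic ordering is represented by a linear ordering L (a duplicate-free
-- list); C ≽ [x,y,z] iff some rotation l₂ ++ l₁ of L = l₁ ++ l₂ contains
-- [x,y,z] as a sublist (arises by omitting entries).
CycContains : ∀ {n} → List (Fin n) → Fin n → Fin n → Fin n → Set
CycContains {n} L x y z =
  ∃[ l₁ ] ∃[ l₂ ] (L ≡ l₁ ++ l₂ × (x ∷ y ∷ z ∷ []) ⊆ (l₂ ++ l₁))

LinearOrderingOf : ∀ {n} → Subset n → List (Fin n) → Set
LinearOrderingOf W L = Unique L × (∀ x → (x LM.∈ L) ⇔ (x ∈ W))

CyclicOn : ∀ {n} → Subset n → Vec3 n → Set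
CyclicOn W u = ∃[ L ] (LinearOrderingOf W L ×
  (∀ x y z → x ∈ W → y ∈ W → z ∈ W →
     (u x y z ≡ true) ⇔ (Distinct3 x y z × CycContains L x y z)))

Cyclic : ∀ {n} → Vec3 n → Set
Cyclic u = CyclicOn ⊤ u

InU : ∀ {n} → Vec3 n → Set
InU {n} u =
  (∀ x y → u x x y ≡ false) ×
  (∀ x y z → (u x y z xor u y z x) ≡ false) ×
  (∀ x y z → Distinct3 x y z → (u x y z xor u y x z) ≡ true) ×
  (∀ t x y z → t ≢ x → t ≢ y → t ≢ z → Distinct3 x y z →
     (u t x y xor u t x z xor u t y z xor u x y z) ≡ false)

-- By the first three axioms of 𝒰, a vector u ∈ 𝒰^Y is determined by its values
-- u(x,y,z) on the ten triples x < y < z, so u coincides with one of 2^10 explicit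
-- vectors, and the four-term axiom on increasing quadruples leaves 64 of them.
-- Whether u_W is cyclic is decidable: a witnessing linear ordering is a
-- duplicate-free list over W, so by pigeonhole one of finitely many lists.  The
-- theorem is then verified on each of the 64 candidates by evaluation.
module Submission where

open import Defs
open import Data.Bool using (Bool; true; false; not; if_then_else_; _xor_)
open import Data.Bool.Properties using () renaming (_≟_ to _≟ᵇ_)
open import Data.Empty using (⊥-elim)
open import Data.Fin using (Fin; zero; suc; _<_)
open import Data.Fin.Properties using (_≟_; _<?_; all?; <-cmp; <⇒≢; <-trans; injective⇒≤)
open import Data.Fin.Subset using (Subset; outside; inside; ⊤; _∈_; ∣_∣)
import Data.Fin.Subset.Properties as Subsetₚ
open import Data.List using (List; []; _∷_; _++_; length; lookup; map; filter; concatMap; allFin; cartesianProduct)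
import Data.List.Membership.Propositional as List
open import Data.List.Membership.Propositional.Properties
  using (∈-allFin; ∈-lookup; ∈-map⁺; ∈-map⁻; ∈-filter⁺; ∈-filter⁻; ∈-concatMap⁺; ∈-cartesianProduct⁺)
open import Data.List.Relation.Unary.All as All using (All; _∷_)
open import Data.List.Relation.Unary.All.Properties using (All¬⇒¬Any)
open import Data.List.Relation.Unary.AllPairs using (_∷_)
open import Data.List.Relation.Unary.Any using (Any; here; there; any?)
open import Data.List.Relation.Unary.Unique.Propositional using (Unique)
open import Data.Nat using (ℕ; _≤_; s≤s)
open import Data.Nat.Properties using (suc-injective)
open import Data.Product using (∃-syntax; ∃₂; _×_; _,_; proj₁; proj₂)
import Data.Product.Properties as Productₚ
open import Data.Sum using (_⊎_; inj₁; inj₂; [_,_]′)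
open import Data.Vec using (_∷_)
import Data.Vec.Properties as Vecₚ
open import Function using (_∘_)
open import Function.Bundles using (_⇔_; mk⇔; Equivalence)
open import Relation.Binary.Definitions using (DecidableEquality; tri<; tri≈; tri>)
open import Relation.Binary.PropositionalEquality
  using (_≡_; _≢_; refl; sym; trans; cong; subst; module ≡-Reasoning)
open import Relation.Nullary
  using (¬_; Dec; yes; no; does; ¬?; map′; _×-dec_; _⊎-dec_; _→-dec_; from-yes)
open import Relation.Unary using (Decidable)

private variable
  n : ℕ

infix 2 _⇔-dec_
_⇔-dec_ : ∀ {a b} {A : Set a} {B : Set b} → Dec A → Dec B → Dec (A ⇔ B)
a? ⇔-dec b? = map′ (λ (f , g) → mk⇔ f g) (λ e → Equivalence.to e , Equivalence.from e)
  ((a? →-dec b?) ×-dec (b? →-dec a?))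

∃-++? : {A : Set} {P : List A → List A → Set} → (∀ ys zs → Dec (P ys zs)) →
        ∀ xs → Dec (∃₂ λ ys zs → xs ≡ ys ++ zs × P ys zs)
∃-++? P? [] = map′ (λ p → [] , [] , refl , p) (λ { ([] , _ , refl , p) → p }) (P? [] [])
∃-++? {P = P} P? (x ∷ xs) = map′ to from (P? [] (x ∷ xs) ⊎-dec ∃-++? (P? ∘ (x ∷_)) xs)
  where
  to : P [] (x ∷ xs) ⊎ (∃₂ λ ys zs → xs ≡ ys ++ zs × P (x ∷ ys) zs) →
       ∃₂ λ ys zs → x ∷ xs ≡ ys ++ zs × P ys zs
  to (inj₁ p) = [] , x ∷ xs , refl , p
  to (inj₂ (ys , zs , refl , p)) = x ∷ ys , zs , refl , p
  from : (∃₂ λ ys zs → x ∷ xs ≡ ys ++ zs × P ys zs) →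
         P [] (x ∷ xs) ⊎ (∃₂ λ ys zs → xs ≡ ys ++ zs × P (x ∷ ys) zs)
  from ([] , _ , refl , p) = inj₁ p
  from (_ ∷ ys , zs , refl , p) = inj₂ (ys , zs , refl , p)

lookup-injective : {A : Set} {xs : List A} → Unique xs → ∀ {i j} → lookup xs i ≡ lookup xs j → i ≡ j
lookup-injective (_ ∷ _) {zero} {zero} _ = refl
lookup-injective (x∉xs ∷ _) {zero} {suc j} eq = ⊥-elim (All.lookup x∉xs (∈-lookup j) eq)
lookup-injective (x∉xs ∷ _) {suc i} {zero} eq = ⊥-elim (All.lookup x∉xs (∈-lookup i) (sym eq))
lookup-injective (_ ∷ xs!) {suc i} {suc j} eq = cong suc (lookup-injective xs! eq)

Unique⇒length≤ : {L : List (Fin n)} → Unique L → length L ≤ n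
Unique⇒length≤ L! = injective⇒≤ (lookup-injective L!)

AgreesOn : Subset n → Vec3 n → List (Fin n) → Set
AgreesOn W u L = ∀ x y z → x ∈ W → y ∈ W → z ∈ W →
  (u x y z ≡ true) ⇔ (Distinct3 x y z × CycContains L x y z)

module _ {n : ℕ} where
  open import Data.List.Membership.DecPropositional (_≟_ {n}) using (_∉?_) renaming (_∈?_ to _∈ₗ?_)
  open import Data.List.Relation.Binary.Sublist.DecPropositional (_≟_ {n}) using (_⊆?_)
  open import Data.List.Relation.Unary.Unique.DecPropositional (_≟_ {n}) using (unique?)

  distinctLists : List (Fin n) → ℕ → List (List (Fin n))
  distinctLists xs ℕ.zero = [] ∷ []
  distinctLists xs (ℕ.suc k) = [] ∷ concatMap (λ l → map (_∷ l) (filter (_∉? l) xs)) (distinctLists xs k)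

  ∈-distinctLists : ∀ {xs k} {L : List (Fin n)} → Unique L → All (List._∈ xs) L → length L ≤ k →
                    L List.∈ distinctLists xs k
  ∈-distinctLists {k = ℕ.zero} {[]} _ _ _ = here refl
  ∈-distinctLists {k = ℕ.suc k} {[]} _ _ _ = here refl
  ∈-distinctLists {k = ℕ.suc k} {x ∷ l} (x∉l ∷ l!) (x∈xs ∷ l⊆xs) (s≤s |l|≤k) =
    there (∈-concatMap⁺ _ (List.lose (∈-distinctLists l! l⊆xs |l|≤k)
                                      (∈-map⁺ (_∷ l) (∈-filter⁺ _ x∈xs (All¬⇒¬Any x∉l)))))

  distinct3? : (x y z : Fin n) → Dec (Distinct3 x y z)
  distinct3? x y z = ¬? (x ≟ y) ×-dec ¬? (y ≟ z) ×-dec ¬? (x ≟ z)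

  cycContains? : (L : List (Fin n)) (x y z : Fin n) → Dec (CycContains L x y z)
  cycContains? L x y z = ∃-++? (λ l₁ l₂ → (x ∷ y ∷ z ∷ []) ⊆? (l₂ ++ l₁)) L

  linearOrderingOf? : (W : Subset n) (L : List (Fin n)) → Dec (LinearOrderingOf W L)
  linearOrderingOf? W L = unique? L ×-dec all? λ x → x ∈ₗ? L ⇔-dec x Subsetₚ.∈? W

  agreesOn? : (W : Subset n) (u : Vec3 n) (L : List (Fin n)) → Dec (AgreesOn W u L)
  agreesOn? W u L = all? λ x → all? λ y → all? λ z →
    x Subsetₚ.∈? W →-dec y Subsetₚ.∈? W →-dec z Subsetₚ.∈? W →-dec
    ((u x y z ≟ᵇ true) ⇔-dec (distinct3? x y z ×-dec cycContains? L x y z))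

cyclicOn? : (W : Subset n) (u : Vec3 n) → Dec (CyclicOn W u)
cyclicOn? {n} W u = map′ (λ any → let (L , _ , ok) = List.find any in L , ok) complete
  (any? (λ L → linearOrderingOf? W L ×-dec agreesOn? W u L) (distinctLists elementsOfW n))
  where
  elementsOfW : List (Fin n)
  elementsOfW = filter (Subsetₚ._∈? W) (allFin n)
  complete : CyclicOn W u → Any (λ L → LinearOrderingOf W L × AgreesOn W u L) (distinctLists elementsOfW n)
  complete (L , ok@((L! , L≈W) , _)) = List.lose (∈-distinctLists L! L⊆W (Unique⇒length≤ L!)) ok
    where
    L⊆W : All (List._∈ elementsOfW) L
    L⊆W = All.tabulate λ {x} x∈L → ∈-filter⁺ _ (∈-allFin x) (Equivalence.to (L≈W x) x∈L)

infix 4 _≗₃_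
_≗₃_ : Vec3 n → Vec3 n → Set
u ≗₃ v = ∀ x y z → u x y z ≡ v x y z

≗₃-sym : {u v : Vec3 n} → u ≗₃ v → v ≗₃ u
≗₃-sym u≗v x y z = sym (u≗v x y z)

CyclicOn-resp-≗₃ : {W : Subset n} {u v : Vec3 n} → u ≗₃ v → CyclicOn W u → CyclicOn W v
CyclicOn-resp-≗₃ {u = u} {v} u≗v (L , lin , agree) = L , lin , λ x y z x∈W y∈W z∈W →
  let open Equivalence (agree x y z x∈W y∈W z∈W)
  in mk⇔ (λ v≡t → to (trans (u≗v x y z) v≡t)) (λ d → trans (sym (u≗v x y z)) (from d))

<⇒distinct3 : {x y z : Fin n} → x < y → y < z → Distinct3 x y z
<⇒distinct3 x<y y<z = <⇒≢ x<y , <⇒≢ y<z , <⇒≢ (<-trans x<y y<z)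

-- The only vector obeying the first three axioms of 𝒰 that agrees with f on
-- increasing triples; f is read nowhere else.
extendIncreasing : Vec3 n → Vec3 n
extendIncreasing f x y z with <-cmp x y | <-cmp y z | <-cmp x z
... | tri≈ _ _ _ | _          | _          = false
... | _          | tri≈ _ _ _ | _          = false
... | tri< _ _ _ | tri< _ _ _ | _          = f x y z
... | tri> _ _ _ | tri> _ _ _ | _          = not (f z y x)
... | _          | _          | tri≈ _ _ _ = false
... | tri< _ _ _ | tri> _ _ _ | tri< _ _ _ = not (f x z y)
... | tri< _ _ _ | tri> _ _ _ | tri> _ _ _ = f z x y
... | tri> _ _ _ | tri< _ _ _ | tri< _ _ _ = not (f y x z)
... | tri> _ _ _ | tri< _ _ _ | tri> _ _ _ = f y z x

FourTermOnIncreasing : Vec3 n → Set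
FourTermOnIncreasing u = ∀ t x → t < x → ∀ y → x < y → ∀ z → y < z →
  (u t x y xor u t x z xor u t y z xor u x y z) ≡ false

FourTermOnIncreasing-resp-≗₃ : {u v : Vec3 n} → u ≗₃ v → FourTermOnIncreasing u → FourTermOnIncreasing v
FourTermOnIncreasing-resp-≗₃ u≗v four t x t<x y x<y z y<z
  rewrite sym (u≗v t x y) | sym (u≗v t x z) | sym (u≗v t y z) | sym (u≗v x y z) = four t x t<x y x<y z y<z

fourTermOnIncreasing? : (u : Vec3 n) → Dec (FourTermOnIncreasing u)
fourTermOnIncreasing? u = all? λ t → all? λ x → t <? x →-dec all? λ y → x <? y →-dec all? λ z → y <? z →-dec
  (u t x y xor u t x z xor u t y z xor u x y z) ≟ᵇ false

module InU-Properties {u : Vec3 n} (u∈𝒰 : InU u) where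

  diagonal : ∀ x y → u x x y ≡ false
  diagonal = proj₁ u∈𝒰

  rotate : ∀ x y z → u x y z ≡ u y z x
  rotate x y z with u x y z | u y z x | proj₁ (proj₂ u∈𝒰) x y z
  ... | false | false | _ = refl
  ... | true  | true  | _ = refl

  swap : ∀ {x y z} → Distinct3 x y z → u y x z ≡ not (u x y z)
  swap {x} {y} {z} d with u x y z | u y x z | proj₁ (proj₂ (proj₂ u∈𝒰)) x y z d
  ... | false | true  | _ = refl
  ... | true  | false | _ = refl

  fourTermOnIncreasing : FourTermOnIncreasing u
  fourTermOnIncreasing t x t<x y x<y z y<z =
    proj₂ (proj₂ (proj₂ u∈𝒰)) t x y z (<⇒≢ t<x) (<⇒≢ t<y) (<⇒≢ (<-trans t<y y<z)) (<⇒distinct3 x<y y<z)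
    where
    t<y : t < y
    t<y = <-trans t<x x<y

  ≗₃-extendIncreasing : {f : Vec3 n} → (∀ {x y z} → x < y → y < z → u x y z ≡ f x y z) →
                        u ≗₃ extendIncreasing f
  ≗₃-extendIncreasing {f} agree x y z with <-cmp x y | <-cmp y z | <-cmp x z
  ... | tri≈ _ refl _ | _ | _ = diagonal x z
  ... | tri< _ _ _ | tri≈ _ refl _ | _ = trans (rotate x y y) (diagonal y x)
  ... | tri> _ _ _ | tri≈ _ refl _ | _ = trans (rotate x y y) (diagonal y x)
  ... | tri< x<y _ _ | tri< y<z _ _ | _ = agree x<y y<z
  ... | tri> _ _ y<x | tri> _ _ z<y | _ = begin
    u x y z       ≡⟨ rotate x y z ⟩
    u y z x       ≡⟨ swap (<⇒distinct3 z<y y<x) ⟩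
    not (u z y x) ≡⟨ cong not (agree z<y y<x) ⟩
    not (f z y x) ∎
    where open ≡-Reasoning
  ... | tri< _ _ _ | tri> _ _ _ | tri≈ _ refl _ = trans (sym (rotate z x y)) (diagonal x y)
  ... | tri> _ _ _ | tri< _ _ _ | tri≈ _ refl _ = trans (sym (rotate z x y)) (diagonal x y)
  ... | tri< _ _ _ | tri> _ _ z<y | tri< x<z _ _ = begin
    u x y z       ≡⟨ rotate z x y ⟨
    u z x y       ≡⟨ swap (<⇒distinct3 x<z z<y) ⟩
    not (u x z y) ≡⟨ cong not (agree x<z z<y) ⟩
    not (f x z y) ∎
    where open ≡-Reasoning
  ... | tri< x<y _ _ | tri> _ _ _ | tri> _ _ z<x = trans (sym (rotate z x y)) (agree z<x x<y)
  ... | tri> _ _ y<x | tri< _ _ _ | tri< x<z _ _ = trans (swap (<⇒distinct3 y<x x<z)) (cong not (agree y<x x<z))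
  ... | tri> _ _ _ | tri< y<z _ _ | tri> _ _ z<x = trans (rotate x y z) (agree y<z z<x)

Triple : ℕ → Set
Triple n = Fin n × Fin n × Fin n

module _ {n : ℕ} where

  _≟₃_ : DecidableEquality (Triple n)
  _≟₃_ = Productₚ.≡-dec _≟_ (Productₚ.≡-dec _≟_ _≟_)

  increasingTriples : List (Triple n)
  increasingTriples = filter (λ (x , y , z) → x <? y ×-dec y <? z)
    (cartesianProduct (allFin n) (cartesianProduct (allFin n) (allFin n)))

  ∈-increasingTriples : ∀ {x y z} → x < y → y < z → (x , y , z) List.∈ increasingTriples
  ∈-increasingTriples {x} {y} {z} x<y y<z = ∈-filter⁺ _
    (∈-cartesianProduct⁺ (∈-allFin x) (∈-cartesianProduct⁺ (∈-allFin y) (∈-allFin z))) (x<y , y<z)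

  update : Triple n → Bool → Vec3 n → Vec3 n
  update t b g x y z = if does ((x , y , z) ≟₃ t) then b else g x y z

  assignmentsOn : List (Triple n) → List (Vec3 n)
  assignmentsOn [] = (λ _ _ _ → false) ∷ []
  assignmentsOn (t ∷ ts) = concatMap (λ g → update t true g ∷ update t false g ∷ []) (assignmentsOn ts)

  ∈-assignmentsOn : ∀ ts (u : Vec3 n) →
    ∃[ g ] (g List.∈ assignmentsOn ts × ∀ {x y z} → (x , y , z) List.∈ ts → g x y z ≡ u x y z)
  ∈-assignmentsOn [] u = _ , here refl , λ ()
  ∈-assignmentsOn (t@(a , b , c) ∷ ts) u with ∈-assignmentsOn ts u
  ... | g , g∈ , agree = update t (u a b c) g , ∈-concatMap⁺ _ (List.lose g∈ (branch (u a b c))) , agree′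
    where
    branch : ∀ v → update t v g List.∈ (update t true g ∷ update t false g ∷ [])
    branch true = here refl
    branch false = there (here refl)
    agree′ : ∀ {x y z} → (x , y , z) List.∈ t ∷ ts → update t (u a b c) g x y z ≡ u x y z
    agree′ {x} {y} {z} p with (x , y , z) ≟₃ t | p
    ... | yes refl | _ = refl
    ... | no ≢t | here eq = ⊥-elim (≢t eq)
    ... | no _ | there p′ = agree p′

allBut : Fin n → Subset n
allBut zero = outside ∷ ⊤
allBut (suc i) = inside ∷ allBut i

∣allBut∣ : (i : Fin (ℕ.suc n)) → ∣ allBut i ∣ ≡ n
∣allBut∣ {n} zero = Subsetₚ.∣⊤∣≡n n
∣allBut∣ {ℕ.suc n} (suc i) = cong ℕ.suc (∣allBut∣ i)

∣p∣≡n⇒allBut : (p : Subset (ℕ.suc n)) → ∣ p ∣ ≡ n → ∃[ i ] p ≡ allBut i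
∣p∣≡n⇒allBut (outside ∷ p) ∣p∣≡n = zero , cong (outside ∷_) (Subsetₚ.∣p∣≡n⇒p≡⊤ ∣p∣≡n)
∣p∣≡n⇒allBut {ℕ.suc n} (inside ∷ p) ∣p∣≡n with ∣p∣≡n⇒allBut p (suc-injective ∣p∣≡n)
... | i , refl = suc i , refl

allButs : ∀ n → List (Subset n)
allButs n = map allBut (allFin n)

∈-allButs⁺ : {p : Subset (ℕ.suc n)} → ∣ p ∣ ≡ n → p List.∈ allButs (ℕ.suc n)
∈-allButs⁺ {p = p} ∣p∣≡n with ∣p∣≡n⇒allBut p ∣p∣≡n
... | i , refl = ∈-map⁺ allBut (∈-allFin i)

∈-allButs⁻ : {p : Subset (ℕ.suc n)} → p List.∈ allButs (ℕ.suc n) → ∣ p ∣ ≡ n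
∈-allButs⁻ {n} p∈ with ∈-map⁻ allBut {xs = allFin (ℕ.suc n)} p∈
... | i , _ , refl = ∣allBut∣ i

ExactlyTwoNonCyclic : Vec3 (ℕ.suc n) → Set
ExactlyTwoNonCyclic {n} u = ∃[ Z₁ ] ∃[ Z₂ ] (Z₁ ≢ Z₂ ×
  (∣ Z₁ ∣ ≡ n × ¬ CyclicOn Z₁ u) × (∣ Z₂ ∣ ≡ n × ¬ CyclicOn Z₂ u) ×
  ((Z : Subset (ℕ.suc n)) → ∣ Z ∣ ≡ n → ¬ CyclicOn Z u → (Z ≡ Z₁ ⊎ Z ≡ Z₂)))

ExactlyTwoNonCyclic-resp-≗₃ : {u v : Vec3 (ℕ.suc n)} → u ≗₃ v → ExactlyTwoNonCyclic u → ExactlyTwoNonCyclic v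
ExactlyTwoNonCyclic-resp-≗₃ {u = u} {v} u≗v (Z₁ , Z₂ , Z₁≢Z₂ , (∣Z₁∣ , ¬cyc₁) , (∣Z₂∣ , ¬cyc₂) , only) =
  Z₁ , Z₂ , Z₁≢Z₂ , (∣Z₁∣ , ¬cyc₁ ∘ back) , (∣Z₂∣ , ¬cyc₂ ∘ back) ,
  λ Z ∣Z∣ ¬cyc → only Z ∣Z∣ (¬cyc ∘ CyclicOn-resp-≗₃ u≗v)
  where
  back : ∀ {W} → CyclicOn W v → CyclicOn W u
  back = CyclicOn-resp-≗₃ (≗₃-sym u≗v)

DistinctPair : {A : Set} → List A → Set
DistinctPair xs = ∃₂ λ a b → a ≢ b × xs ≡ a ∷ b ∷ []

distinctPair? : {A : Set} → DecidableEquality A → (xs : List A) → Dec (DistinctPair xs)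
distinctPair? _≟ₐ_ (a ∷ b ∷ []) =
  map′ (λ a≢b → a , b , a≢b , refl) (λ { (_ , _ , a≢b , refl) → a≢b }) (¬? (a ≟ₐ b))
distinctPair? _ [] = no λ { (_ , _ , _ , ()) }
distinctPair? _ (_ ∷ []) = no λ { (_ , _ , _ , ()) }
distinctPair? _ (_ ∷ _ ∷ _ ∷ _) = no λ { (_ , _ , _ , ()) }

nonCyclic? : (u : Vec3 n) (Z : Subset n) → Dec (¬ CyclicOn Z u)
nonCyclic? u Z = ¬? (cyclicOn? Z u)

nonCyclicAllBut : Vec3 n → List (Subset n)
nonCyclicAllBut {n} u = filter (nonCyclic? u) (allButs n)

module _ {A : Set} {P : A → Set} (P? : Decidable P) {xs : List A} {a b : A} (eq : filter P? xs ≡ a ∷ b ∷ []) where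

  filter≡pair⇒∈ : ∀ {z} → z List.∈ a ∷ b ∷ [] → z List.∈ xs × P z
  filter≡pair⇒∈ {z} z∈ = ∈-filter⁻ P? (subst (z List.∈_) (sym eq) z∈)

  filter≡pair⇒≡ : ∀ {z} → z List.∈ xs → P z → z ≡ a ⊎ z ≡ b
  filter≡pair⇒≡ {z} z∈xs pz with subst (z List.∈_) eq (∈-filter⁺ P? z∈xs pz)
  ... | here z≡a = inj₁ z≡a
  ... | there (here z≡b) = inj₂ z≡b

DistinctPair⇒ExactlyTwoNonCyclic : {u : Vec3 (ℕ.suc n)} → DistinctPair (nonCyclicAllBut u) → ExactlyTwoNonCyclic u
DistinctPair⇒ExactlyTwoNonCyclic {n} {u} (Z₁ , Z₂ , Z₁≢Z₂ , eq) =
  Z₁ , Z₂ , Z₁≢Z₂ , nonCyclic (here refl) , nonCyclic (there (here refl)) ,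
  λ Z ∣Z∣ ¬cyc → filter≡pair⇒≡ (nonCyclic? u) {xs = allButs (ℕ.suc n)} eq (∈-allButs⁺ ∣Z∣) ¬cyc
  where
  nonCyclic : ∀ {Z} → Z List.∈ Z₁ ∷ Z₂ ∷ [] → ∣ Z ∣ ≡ n × ¬ CyclicOn Z u
  nonCyclic Z∈ with filter≡pair⇒∈ (nonCyclic? u) {xs = allButs (ℕ.suc n)} eq Z∈
  ... | Z∈allButs , ¬cyc = ∈-allButs⁻ Z∈allButs , ¬cyc

-- Stated as a disjunction so that a non-cyclic u is settled by the five cheap
-- searches over orderings of 4-sets, without exhausting the orderings of Y.
Dichotomy : Vec3 n → Set
Dichotomy u = FourTermOnIncreasing u → DistinctPair (nonCyclicAllBut u) ⊎ Cyclic u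

dichotomy? : (u : Vec3 n) → Dec (Dichotomy u)
dichotomy? u = fourTermOnIncreasing? u →-dec
  (distinctPair? (Vecₚ.≡-dec _≟ᵇ_) (nonCyclicAllBut u) ⊎-dec cyclicOn? ⊤ u)

Dichotomy⇒ExactlyTwoNonCyclic : {u v : Vec3 (ℕ.suc n)} → u ≗₃ v → Dichotomy v →
  FourTermOnIncreasing u → ¬ Cyclic u → ExactlyTwoNonCyclic u
Dichotomy⇒ExactlyTwoNonCyclic {v = v} u≗v dichotomy four ¬cyclic =
  [ ExactlyTwoNonCyclic-resp-≗₃ (≗₃-sym u≗v) ∘ DistinctPair⇒ExactlyTwoNonCyclic {u = v}
  , ⊥-elim ∘ ¬cyclic ∘ CyclicOn-resp-≗₃ (≗₃-sym u≗v)
  ]′ (dichotomy (FourTermOnIncreasing-resp-≗₃ u≗v four))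

candidates : List (Vec3 5)
candidates = map extendIncreasing (assignmentsOn increasingTriples)

dichotomy-candidates : All Dichotomy candidates
dichotomy-candidates = from-yes (All.all? dichotomy? candidates)

lemma6 : (u : Vec3 5) → InU u → ¬ Cyclic u →
    ∃[ Z₁ ] ∃[ Z₂ ] (Z₁ ≢ Z₂ ×
      (∣ Z₁ ∣ ≡ 4 × ¬ CyclicOn Z₁ u) × (∣ Z₂ ∣ ≡ 4 × ¬ CyclicOn Z₂ u) ×
      ((Z : Subset 5) → ∣ Z ∣ ≡ 4 → ¬ CyclicOn Z u → (Z ≡ Z₁ ⊎ Z ≡ Z₂)))
lemma6 u u∈𝒰 ¬cyclic =
  Dichotomy⇒ExactlyTwoNonCyclic {v = v} u≗v (All.lookup dichotomy-candidates v∈) fourTermOnIncreasing ¬cyclic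
  where
  open InU-Properties {u = u} u∈𝒰
  g : Vec3 5
  g = proj₁ (∈-assignmentsOn increasingTriples u)
  v : Vec3 5
  v = extendIncreasing g
  v∈ : v List.∈ candidates
  v∈ = ∈-map⁺ extendIncreasing (proj₁ (proj₂ (∈-assignmentsOn increasingTriples u)))
  u≗v : u ≗₃ v
  u≗v = ≗₃-extendIncreasing λ x<y y<z →
    sym (proj₂ (proj₂ (∈-assignmentsOn increasingTriples u)) (∈-increasingTriples x<y y<z))
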